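{- Let $f\colon\mathbb Z_p\to\mathbb Z_p$ be uniformly differentiable modulo $p^2$ on $\mathbb Z_p$ with integer-valued derivative modulo $p^2$. Then $f$ is asymptotically ergodic if and only if $f$ is transitive modulo $p^{N_2(f)+1}$ when $p$ is odd, respectively transitive modulo $2^{N_2(f)+2}$ when $p=2$.
   Context: $\mathbb Z_p$, $\mathbb Q_p$, $\|\cdot\|_p$ are the $p$-adic integers, numbers and norm; $a\equiv b\pmod{p^s}$ means $\|a-b\|_p\le p^{ -s}$. $f$ is uniformly differentiable modulo $p^k$ on $\mathbb Z_p$ if there exist $N\in\mathbb N$ and for every $u\in\mathbb Z_p$ an element $f'_k(u)\in\mathbb Q_p$ such that for every integer $K\ge N$, every $u\in\mathbb Z_p$ and every $h\in\mathbb Z_p$ with $\|h\|_p\le p^{ -K}$: $f(u+h)\equiv f(u)+hf'_k(u)\pmod{p^{k+K}}$; the least such $N$ is $N_k(f)$. The derivative modulo $p^k$ is integer-valued if $f'_k(u)$ can be chosen in $\mathbb Z_p$ for every $u$. $f$ is transitive modulo $p^k$ if the map $\{0,\dots,p^k-1\}\to\mathbb Z/p^k$, $x\mapsto f(x)\bmod p^k$ (identifying $\{0,\dots,p^k-1\}$ with $\mathbb Z/p^k$) is a single-cycle permutation; $f$ is asymptotically ergodic if it is transitive modulo $p^k$ for all sufficiently large $k$. -}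

module Defs where

open import Data.Nat using (ℕ; zero; suc; _+_; _*_; _^_; _≤_; _<_; _≥_; NonZero)
open import Data.Nat.Properties using (m^n≢0)
open import Data.Nat.DivMod using (_%_; m%n<n; %-distribˡ-+; %-distribˡ-*; m∣n⇒o%n%m≡o%m)
open import Data.Nat.Divisibility using (divides)
open import Data.Product using (Σ; _×_; _,_; ∃)
open import Function using (_∘_)
open import Relation.Nullary using (¬_)
open import Relation.Binary.PropositionalEquality using (_≡_; refl; trans; cong₂; sym)

-- The p-adic integers ℤ_p, represented as compatible sequences of
-- residues: seq k ∈ {0,…,p^k - 1} is the class of x modulo p^k.

module _ (p : ℕ) .{{_ : NonZero p}} where

  _mod^_ : ℕ → ℕ → ℕ
  n mod^ k = _%_ n (p ^ k) {{m^n≢0 p k}}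

  record ℤp : Set where
    constructor mkℤp
    field
      seq : ℕ → ℕ
      seq< : ∀ k → seq k < p ^ k
      coh : ∀ k → seq (suc k) mod^ k ≡ seq k
  open ℤp public

  private
    step : ∀ k o → (o mod^ suc k) mod^ k ≡ o mod^ k
    step k o = m∣n⇒o%n%m≡o%m (p ^ k) (p ^ suc k) o {{m^n≢0 p k}} {{m^n≢0 p (suc k)}} (divides p refl)

  _≈_ : ℤp → ℤp → Set
  x ≈ y = ∀ k → seq x k ≡ seq y k

  -- a ≡ b (mod p^s), i.e. ‖a - b‖_p ≤ p^{-s}
  _≡_[mod^_] : ℤp → ℤp → ℕ → Set
  x ≡ y [mod^ s ] = seq x s ≡ seq y s

  ι : ℕ → ℤp
  ι n = mkℤp (λ k → n mod^ k) (λ k → m%n<n n (p ^ k) {{m^n≢0 p k}}) (λ k → step k n)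

  _⊕_ : ℤp → ℤp → ℤp
  x ⊕ y = mkℤp (λ k → (seq x k + seq y k) mod^ k)
               (λ k → m%n<n _ (p ^ k) {{m^n≢0 p k}})
               (λ k → trans (step k (seq x (suc k) + seq y (suc k)))
                        (trans (%-distribˡ-+ (seq x (suc k)) (seq y (suc k)) (p ^ k) {{m^n≢0 p k}})
                               (cong₂ (λ a b → (a + b) mod^ k) (coh x k) (coh y k))))

  _⊗_ : ℤp → ℤp → ℤp
  x ⊗ y = mkℤp (λ k → (seq x k * seq y k) mod^ k)
               (λ k → m%n<n _ (p ^ k) {{m^n≢0 p k}})
               (λ k → trans (step k (seq x (suc k) * seq y (suc k)))
                        (trans (%-distribˡ-* (seq x (suc k)) (seq y (suc k)) (p ^ k) {{m^n≢0 p k}})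
                               (cong₂ (λ a b → (a * b) mod^ k) (coh x k) (coh y k))))

  -- a map ℤ_p → ℤ_p (as a function on the set ℤ_p it respects equality)
  Respects≈ : (ℤp → ℤp) → Set
  Respects≈ f = ∀ x y → x ≈ y → f x ≈ f y

  UDIntWith : ℕ → (ℤp → ℤp) → ℕ → Set
  UDIntWith k f N =
    Σ (ℤp → ℤp) λ f' →
      ∀ K → K ≥ N → ∀ u h → seq h K ≡ 0 →
        f (u ⊕ h) ≡ f u ⊕ (h ⊗ f' u) [mod^ (k + K) ]

  IsNk : ℕ → (ℤp → ℤp) → ℕ → Set
  IsNk k f N = UDIntWith k f N × (∀ M → M < N → ¬ UDIntWith k f M)

  reduce : (ℤp → ℤp) → ℕ → ℕ → ℕ
  reduce f k x = seq (f (ι x)) k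

  iter : (ℕ → ℕ) → ℕ → ℕ → ℕ
  iter g zero x = x
  iter g (suc n) x = g (iter g n x)

  TransitiveMod : (ℤp → ℤp) → ℕ → Set
  TransitiveMod f k =
    (∀ x y → x < p ^ k → y < p ^ k → reduce f k x ≡ reduce f k y → x ≡ y) ×
    (∀ x y → x < p ^ k → y < p ^ k → ∃ λ n → iter (reduce f k) n x ≡ y)

  AsymptoticallyErgodic : (ℤp → ℤp) → Set
  AsymptoticallyErgodic f = ∃ λ k₀ → ∀ k → k ≥ k₀ → TransitiveMod f k

-- Write F_m for the map induced by f on ℤ/p^m and δ(x) for f′(x) mod p². For K ≥ N = N₂(f),
-- F_{K+2}(x + p^K t) ≡ F_{K+2}(x) + p^K t δ(x) (mod p^{K+2}); hence F_m is well defined for m ≥ N, δ only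
-- depends on x mod p^N, and by the chain rule fⁿ(x + p^K t) ≡ fⁿ(x) + p^K t aₙ(x), where aₙ is the
-- product of δ along the orbit of x. If f is transitive modulo p^K and p^{K+1}, then
-- f^{p^K}(z) ≡ z + p^K c with c ≢ 0 (mod p), and a = a_{p^K}(z) ≡ 1 (mod p), since otherwise some z + p^K t
-- would lie on a cycle of length p^K modulo p^{K+1}. Consequently
-- f^{p^{K+1}}(z) ≡ z + p^K c (1 + a + ⋯ + a^{p−1}) ≡ z + p^{K+1} c (mod p^{K+2}), so f is transitive
-- modulo p^{K+2} as well. The geometric sum is ≡ p (mod p²) because p ∣ p(p − 1)/2 for odd p; for p = 2
-- it needs a ≡ 1 (mod 4), which holds one level higher because a_{p^{K+1}} = a_{p^K}^p. Transitivity
-- modulo p^{N+1}, resp. 2^{N+2}, therefore propagates upwards, and it always descends to lower levels ≥ N.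

module Submission where

open import Defs
open import Data.Nat using (ℕ; _+_; NonZero)
open import Data.Nat.Primality using (Prime)
open import Data.Product using (_×_)
open import Function using (_⇔_)
open import Relation.Binary.PropositionalEquality using (_≡_; _≢_)

open import Data.Nat using (zero; suc; z<s; s≤s⁻¹; _*_; _∸_; _^_; _%_; _/_; _≤_; _<_; _≟_; z≤n; >-nonZero; ≢-nonZero; nonTrivial⇒n>1)
open import Data.Nat.Properties
open import Data.Nat.DivMod using (m*n%n≡0; %-distribˡ-+; m%n<n; m≡m%n+[m/n]*n; [m+kn]%n≡m%n; m<n⇒m%n≡m)
open import Data.Nat.Divisibility using (_∣_; divides; ∣m+n∣m⇒∣n; ∣⇒≤; ∣-refl; m∣m*n)
open import Data.Nat.Primality using (euclidsLemma; prime⇒nonTrivial)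
open import Data.Nat.Coprimality using (prime⇒coprime; coprime-Bézout)
open import Data.Nat.GCD using (module Bézout)
open import Data.Nat.GeneralisedArithmetic using (fold; fold-+)
open import Data.Nat.Tactic.RingSolver using (solve; solve-∀)
open import Data.List using (_∷_; [])
open import Data.Fin using (Fin; toℕ; fromℕ<)
import Data.Fin.Properties as Fin
open import Data.Product using (∃; _,_; proj₁; proj₂)
open import Data.Sum using (inj₁; inj₂)
open import Function using (mk⇔)
open import Relation.Nullary using (¬_; Dec; yes; no; contradiction)
open import Relation.Nullary.Decidable using (map′; decidable-stable)
open import Level using (0ℓ)
open import Relation.Binary.Bundles using (Setoid)
open import Relation.Binary.PropositionalEquality using (refl; sym; trans; cong; cong₂; subst; subst₂; module ≡-Reasoning)
import Relation.Binary.Reasoning.Setoid as SetoidReasoning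

-- Congruences on ℕ, witnessed without truncated subtraction.

infix 4 _≡_[mod_]

record _≡_[mod_] (a b n : ℕ) : Set where
  constructor mod-by
  field
    k l : ℕ
    eq : a + n * k ≡ b + n * l

module _ {n : ℕ} where

  mod-refl : ∀ {a} → a ≡ a [mod n ]
  mod-refl = mod-by 0 0 refl

  mod-reflexive : ∀ {a b} → a ≡ b → a ≡ b [mod n ]
  mod-reflexive refl = mod-refl

  mod-sym : ∀ {a b} → a ≡ b [mod n ] → b ≡ a [mod n ]
  mod-sym (mod-by k l e) = mod-by l k (sym e)

  mod-trans : ∀ {a b c} → a ≡ b [mod n ] → b ≡ c [mod n ] → a ≡ c [mod n ]
  mod-trans {a} {b} {c} (mod-by k l e) (mod-by k′ l′ e′) = mod-by (k + k′) (l + l′) (begin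
    a + n * (k + k′)      ≡⟨ solve (a ∷ n ∷ k ∷ k′ ∷ []) ⟩
    (a + n * k) + n * k′  ≡⟨ cong (_+ n * k′) e ⟩
    (b + n * l) + n * k′  ≡⟨ solve (b ∷ n ∷ l ∷ k′ ∷ []) ⟩
    (b + n * k′) + n * l  ≡⟨ cong (_+ n * l) e′ ⟩
    (c + n * l′) + n * l  ≡⟨ solve (c ∷ n ∷ l ∷ l′ ∷ []) ⟩
    c + n * (l + l′)      ∎)
    where open ≡-Reasoning

  mod-setoid : Setoid 0ℓ 0ℓ
  mod-setoid = record
    { Carrier = ℕ
    ; _≈_ = λ a b → a ≡ b [mod n ]
    ; isEquivalence = record { refl = mod-refl ; sym = mod-sym ; trans = mod-trans }
    }

  +-cong-mod : ∀ {a b c d} → a ≡ b [mod n ] → c ≡ d [mod n ] → a + c ≡ b + d [mod n ]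
  +-cong-mod {a} {b} {c} {d} (mod-by k l e) (mod-by k′ l′ e′) = mod-by (k + k′) (l + l′) (begin
    a + c + n * (k + k′)         ≡⟨ solve (a ∷ c ∷ n ∷ k ∷ k′ ∷ []) ⟩
    (a + n * k) + (c + n * k′)   ≡⟨ cong₂ _+_ e e′ ⟩
    (b + n * l) + (d + n * l′)   ≡⟨ solve (b ∷ d ∷ n ∷ l ∷ l′ ∷ []) ⟩
    b + d + n * (l + l′)         ∎)
    where open ≡-Reasoning

  +-congˡ-mod : ∀ a {b c} → b ≡ c [mod n ] → a + b ≡ a + c [mod n ]
  +-congˡ-mod a = +-cong-mod (mod-refl {a})

  *-congˡ-mod : ∀ c {a b} → a ≡ b [mod n ] → c * a ≡ c * b [mod n ]
  *-congˡ-mod c {a} {b} (mod-by k l e) = mod-by (c * k) (c * l) (begin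
    c * a + n * (c * k)  ≡⟨ solve (c ∷ a ∷ n ∷ k ∷ []) ⟩
    c * (a + n * k)      ≡⟨ cong (c *_) e ⟩
    c * (b + n * l)      ≡⟨ solve (c ∷ b ∷ n ∷ l ∷ []) ⟩
    c * b + n * (c * l)  ∎)
    where open ≡-Reasoning

  *-congʳ-mod : ∀ c {a b} → a ≡ b [mod n ] → a * c ≡ b * c [mod n ]
  *-congʳ-mod c {a} {b} e = subst₂ (λ x y → x ≡ y [mod n ]) (*-comm c a) (*-comm c b) (*-congˡ-mod c e)

  *-cong-mod : ∀ {a b c d} → a ≡ b [mod n ] → c ≡ d [mod n ] → a * c ≡ b * d [mod n ]
  *-cong-mod {b = b} {c} e e′ = mod-trans (*-congʳ-mod c e) (*-congˡ-mod b e′)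

  +-cancelʳ-mod : ∀ c {a b} → a + c ≡ b + c [mod n ] → a ≡ b [mod n ]
  +-cancelʳ-mod c {a} {b} (mod-by k l e) = mod-by k l (+-cancelʳ-≡ c _ _ (begin
    a + n * k + c  ≡⟨ solve (a ∷ n ∷ k ∷ c ∷ []) ⟩
    a + c + n * k  ≡⟨ e ⟩
    b + c + n * l  ≡⟨ solve (b ∷ n ∷ l ∷ c ∷ []) ⟩
    b + n * l + c  ∎))
    where open ≡-Reasoning

  +-cancelˡ-mod : ∀ c {a b} → c + a ≡ c + b [mod n ] → a ≡ b [mod n ]
  +-cancelˡ-mod c {a} {b} e = +-cancelʳ-mod c (subst₂ (λ x y → x ≡ y [mod n ]) (+-comm c a) (+-comm c b) e)

  n*x≡0-mod : ∀ x → n * x ≡ 0 [mod n ]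
  n*x≡0-mod x = mod-by 0 x (solve (n ∷ x ∷ []))

  x*n≡0-mod : ∀ x → x * n ≡ 0 [mod n ]
  x*n≡0-mod x = subst (_≡ 0 [mod n ]) (*-comm n x) (n*x≡0-mod x)

  n≡0-mod : n ≡ 0 [mod n ]
  n≡0-mod = mod-by 0 1 (solve (n ∷ []))

  %-mod : .{{_ : NonZero n}} → ∀ a → a % n ≡ a [mod n ]
  %-mod a = mod-by (a / n) 0 (begin
    a % n + n * (a / n)  ≡⟨ cong (a % n +_) (*-comm n (a / n)) ⟩
    a % n + a / n * n    ≡⟨ m≡m%n+[m/n]*n a n ⟨
    a                    ≡⟨ +-identityʳ a ⟨
    a + 0                ≡⟨ cong (a +_) (*-zeroʳ n) ⟨
    a + n * 0            ∎)
    where open ≡-Reasoning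

  mod⇒%≡ : .{{_ : NonZero n}} → ∀ {a b} → a ≡ b [mod n ] → a % n ≡ b % n
  mod⇒%≡ {a} {b} (mod-by k l e) = begin
    a % n              ≡⟨ [m+kn]%n≡m%n a k n ⟨
    (a + k * n) % n    ≡⟨ cong (λ x → (a + x) % n) (*-comm k n) ⟩
    (a + n * k) % n    ≡⟨ cong (_% n) e ⟩
    (b + n * l) % n    ≡⟨ cong (λ x → (b + x) % n) (*-comm n l) ⟩
    (b + l * n) % n    ≡⟨ [m+kn]%n≡m%n b l n ⟩
    b % n              ∎
    where open ≡-Reasoning

  %≡⇒mod : .{{_ : NonZero n}} → ∀ {a b} → a % n ≡ b % n → a ≡ b [mod n ]
  %≡⇒mod {a} {b} e = mod-trans (mod-sym (%-mod a)) (mod-trans (mod-reflexive e) (%-mod b))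

  mod? : .{{_ : NonZero n}} → ∀ a b → Dec (a ≡ b [mod n ])
  mod? a b = map′ %≡⇒mod mod⇒%≡ (a % n ≟ b % n)

  mod⇒≡ : ∀ {a b} → a < n → b < n → a ≡ b [mod n ] → a ≡ b
  mod⇒≡ {a} {b} a<n b<n e = begin
    a      ≡⟨ m<n⇒m%n≡m a<n ⟨
    a % n  ≡⟨ mod⇒%≡ e ⟩
    b % n  ≡⟨ m<n⇒m%n≡m b<n ⟩
    b      ∎
    where
    open ≡-Reasoning
    instance
      n≢0 : NonZero n
      n≢0 = >-nonZero (≤-<-trans z≤n a<n)

  mod-0⇒∣ : ∀ {c} → c ≡ 0 [mod n ] → n ∣ c
  mod-0⇒∣ {c} (mod-by k l e) =
    ∣m+n∣m⇒∣n (divides l (trans (+-comm (n * k) c) (trans e (*-comm n l)))) (m∣m*n k)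

module ModReasoning (n : ℕ) = SetoidReasoning (mod-setoid {n})

inverse-cancel-mod : ∀ {n u c} t → u * c ≡ 1 [mod n ] → u * t * c ≡ t [mod n ]
inverse-cancel-mod {n} {u} {c} t u*c≡1 = begin
  u * t * c    ≡⟨ regroup u t c ⟩
  t * (u * c)  ≈⟨ *-congˡ-mod t u*c≡1 ⟩
  t * 1        ≡⟨ *-identityʳ t ⟩
  t            ∎
  where
  open ModReasoning n
  regroup : ∀ u t c → u * t * c ≡ t * (u * c)
  regroup = solve-∀

x+n*0≡x : ∀ x n → x + n * 0 ≡ x
x+n*0≡x x n = trans (cong (x +_) (*-zeroʳ n)) (+-identityʳ x)

+-*-distrib : ∀ x n a b → x + n * a + n * b ≡ x + n * (a + b)
+-*-distrib x n a b = trans (+-assoc x (n * a) (n * b)) (cong (x +_) (sym (*-distribˡ-+ n a b)))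

mod-≡ : ∀ {a b n m} → n ≡ m → a ≡ b [mod n ] → a ≡ b [mod m ]
mod-≡ refl e = e

mod-weaken : ∀ {a b n} m → a ≡ b [mod m * n ] → a ≡ b [mod n ]
mod-weaken {a} {b} {n} m (mod-by k l e) = mod-by (m * k) (m * l) (begin
  a + n * (m * k)  ≡⟨ solve (a ∷ n ∷ m ∷ k ∷ []) ⟩
  a + m * n * k    ≡⟨ e ⟩
  b + m * n * l    ≡⟨ solve (b ∷ n ∷ m ∷ l ∷ []) ⟩
  b + n * (m * l)  ∎)
  where open ≡-Reasoning

mod-weaken-^ : ∀ {a b} p {j m} → j ≤ m → a ≡ b [mod p ^ m ] → a ≡ b [mod p ^ j ]
mod-weaken-^ {a} {b} p {j} {m} j≤m e = mod-weaken (p ^ (m ∸ j)) (mod-≡ p^m≡p^[m∸j]*p^j e)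
  where
  p^m≡p^[m∸j]*p^j : p ^ m ≡ p ^ (m ∸ j) * p ^ j
  p^m≡p^[m∸j]*p^j = trans (cong (p ^_) (sym (m∸n+n≡m j≤m))) (^-distribˡ-+-* p (m ∸ j) j)

*-scale-mod : ∀ {a b n} c → a ≡ b [mod n ] → c * a ≡ c * b [mod n * c ]
*-scale-mod {a} {b} {n} c (mod-by k l e) = mod-by k l (begin
  c * a + n * c * k  ≡⟨ solve (c ∷ a ∷ n ∷ k ∷ []) ⟩
  c * (a + n * k)    ≡⟨ cong (c *_) e ⟩
  c * (b + n * l)    ≡⟨ solve (c ∷ b ∷ n ∷ l ∷ []) ⟩
  c * b + n * c * l  ∎)
  where open ≡-Reasoning

*-cancel-mod : ∀ {a b n} c .{{_ : NonZero c}} → c * a ≡ c * b [mod n * c ] → a ≡ b [mod n ]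
*-cancel-mod {a} {b} {n} c (mod-by k l e) = mod-by k l (*-cancelˡ-≡ _ _ c (begin
  c * (a + n * k)    ≡⟨ solve (c ∷ a ∷ n ∷ k ∷ []) ⟩
  c * a + n * c * k  ≡⟨ e ⟩
  c * b + n * c * l  ≡⟨ solve (c ∷ b ∷ n ∷ l ∷ []) ⟩
  c * (b + n * l)    ∎))
  where open ≡-Reasoning

mod-lift : ∀ {a b P} Q .{{_ : NonZero Q}} → a ≡ b [mod P ] → ∃ λ e → b ≡ a + P * e [mod Q * P ]
mod-lift {a} {b} {P} (suc q) (mod-by k l e) = k + q * l , mod-by l 0 (begin
  b + suc q * P * l             ≡⟨ solve (b ∷ P ∷ q ∷ l ∷ []) ⟩
  (b + P * l) + P * (q * l)     ≡⟨ cong (_+ P * (q * l)) e ⟨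
  (a + P * k) + P * (q * l)     ≡⟨ solve (a ∷ P ∷ k ∷ q ∷ l ∷ []) ⟩
  a + P * (k + q * l) + suc q * P * 0 ∎)
  where open ≡-Reasoning

shift-cancel-mod : ∀ {x s t P} m .{{_ : NonZero P}} → x + P * s ≡ x + P * t [mod m * P ] → s ≡ t [mod m ]
shift-cancel-mod {x} m e = *-cancel-mod _ (+-cancelˡ-mod x e)

shift-vanish-mod : ∀ {x t m} P → t ≡ 0 [mod m ] → x + P * t ≡ x [mod m * P ]
shift-vanish-mod {x} P t≡0 = mod-trans (+-congˡ-mod x (*-scale-mod P t≡0)) (mod-reflexive (x+n*0≡x x P))

-- With 1 + q = n, q represents −1 modulo n.
≡-1⇒*≡1-mod : ∀ {n q a} → 1 + q ≡ n → a + 1 ≡ 0 [mod n ] → q * a ≡ 1 [mod n ]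
≡-1⇒*≡1-mod {n} {q} {a} 1+q≡n a+1≡0 = +-cancelʳ-mod q (begin
  q * a + q    ≡⟨ solve (q ∷ a ∷ []) ⟩
  q * (a + 1)  ≈⟨ *-congˡ-mod q a+1≡0 ⟩
  q * 0        ≡⟨ *-zeroʳ q ⟩
  0            ≈⟨ n≡0-mod ⟨
  n            ≡⟨ 1+q≡n ⟨
  1 + q        ∎)
  where open ModReasoning n

fold-suc : ∀ {A : Set} (h : A → A) x n → fold x h (suc n) ≡ fold (h x) h n
fold-suc h x n = trans (cong (fold x h) (+-comm 1 n)) (fold-+ x h n {1})

fold-periodic-* : ∀ {A : Set} (h : A → A) {x r} → fold x h r ≡ x → ∀ k → fold x h (k * r) ≡ x
fold-periodic-* h         per zero    = refl
fold-periodic-* h {x} {r} per (suc k) = begin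
  fold x h (r + k * r)          ≡⟨ fold-+ x h r ⟩
  fold (fold x h (k * r)) h r   ≡⟨ cong (λ y → fold y h r) (fold-periodic-* h per k) ⟩
  fold x h r                    ≡⟨ per ⟩
  x                             ∎
  where open ≡-Reasoning

fold-periodic-% : ∀ {A : Set} (h : A → A) {x} r .{{_ : NonZero r}} → fold x h r ≡ x → ∀ n → fold x h n ≡ fold x h (n % r)
fold-periodic-% h {x} r per n = begin
  fold x h n                              ≡⟨ cong (fold x h) (m≡m%n+[m/n]*n n r) ⟩
  fold x h (n % r + n / r * r)            ≡⟨ fold-+ x h (n % r) ⟩
  fold (fold x h (n / r * r)) h (n % r)   ≡⟨ cong (λ y → fold y h (n % r)) (fold-periodic-* h per (n / r)) ⟩
  fold x h (n % r)                        ∎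
  where open ≡-Reasoning

module SingleOrbit (h : ℕ → ℕ) (P : ℕ) (h-< : ∀ x → x < P → h x < P) where

  fold-< : ∀ n {x} → x < P → fold x h n < P
  fold-< zero    x<P = x<P
  fold-< (suc n) x<P = h-< _ (fold-< n x<P)

  OrbitCovers : ℕ → Set
  OrbitCovers w = ∀ y → y < P → ∃ λ n → fold w h n ≡ y

  Transitive : Set
  Transitive = ∀ w → w < P → OrbitCovers w

  -- n ↦ n mod r maps the P orbit points injectively into Fin r.
  covering-period-≥ : ∀ {w} → OrbitCovers w → ∀ r → 0 < r → fold w h r ≡ w → P ≤ r
  covering-period-≥ {w} covers r@(suc _) _ per = Fin.injective⇒≤ {f = time-mod-r} injective
    where
    time : Fin P → ℕ
    time y = proj₁ (covers (toℕ y) (Fin.toℕ<n y))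
    time-mod-r : Fin P → Fin r
    time-mod-r y = fromℕ< (m%n<n (time y) r)
    injective : ∀ {y y′} → time-mod-r y ≡ time-mod-r y′ → y ≡ y′
    injective {y} {y′} eq = Fin.toℕ-injective (begin
      toℕ y                    ≡⟨ proj₂ (covers (toℕ y) (Fin.toℕ<n y)) ⟨
      fold w h (time y)        ≡⟨ fold-periodic-% h r per (time y) ⟩
      fold w h (time y % r)    ≡⟨ cong (fold w h) (Fin.toℕ-fromℕ< (m%n<n (time y) r)) ⟨
      fold w h (toℕ (time-mod-r y))  ≡⟨ cong (λ i → fold w h (toℕ i)) eq ⟩
      fold w h (toℕ (time-mod-r y′)) ≡⟨ cong (fold w h) (Fin.toℕ-fromℕ< (m%n<n (time y′) r)) ⟩
      fold w h (time y′ % r)   ≡⟨ fold-periodic-% h r per (time y′) ⟨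
      fold w h (time y′)       ≡⟨ proj₂ (covers (toℕ y′) (Fin.toℕ<n y′)) ⟩
      toℕ y′                   ∎)
      where open ≡-Reasoning

  -- By pigeonhole two of the points hᶦ x, i ≤ P, coincide; by the bound above they must be x and hᴾ x.
  transitive⇒period : Transitive → ∀ {x} → x < P → fold x h P ≡ x
  transitive⇒period transitive {x} x<P
    with i , j , i<j , hⁱx≡hʲx ← Fin.pigeonhole (n<1+n P) (λ (i : Fin (suc P)) → fromℕ< (fold-< (toℕ i) x<P))
    = begin
      fold x h P        ≡⟨ cong (fold x h) j≡P ⟨
      fold x h (toℕ j)  ≡⟨ same-point ⟨
      fold x h (toℕ i)  ≡⟨ cong (fold x h) i≡0 ⟩
      x                 ∎
    where
    open ≡-Reasoning
    same-point : fold x h (toℕ i) ≡ fold x h (toℕ j)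
    same-point = trans (sym (Fin.toℕ-fromℕ< (fold-< (toℕ i) x<P))) (trans (cong toℕ hⁱx≡hʲx) (Fin.toℕ-fromℕ< (fold-< (toℕ j) x<P)))
    r : ℕ
    r = toℕ j ∸ toℕ i
    j≡r+i : toℕ j ≡ r + toℕ i
    j≡r+i = sym (m∸n+n≡m (<⇒≤ i<j))
    period-r : fold (fold x h (toℕ i)) h r ≡ fold x h (toℕ i)
    period-r = trans (sym (fold-+ x h r)) (trans (cong (fold x h) (sym j≡r+i)) (sym same-point))
    P≤r : P ≤ r
    P≤r = covering-period-≥ (transitive _ (fold-< (toℕ i) x<P)) r (m<n⇒0<n∸m i<j) period-r
    j≤P : toℕ j ≤ P
    j≤P = s≤s⁻¹ (Fin.toℕ<n j)
    i≡0 : toℕ i ≡ 0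
    i≡0 = n≤0⇒n≡0 (+-cancelˡ-≤ r (toℕ i) 0 (subst₂ _≤_ j≡r+i (sym (+-identityʳ r)) (≤-trans j≤P P≤r)))
    j≡P : toℕ j ≡ P
    j≡P = ≤-antisym j≤P (≤-trans P≤r (m∸n≤m (toℕ j) (toℕ i)))

  -- If y = hᵐ x with 0 < m mod P, then h x would return to itself after m mod P < P steps.
  transitive⇒injective : Transitive → ∀ {x y} → x < P → y < P → h x ≡ h y → x ≡ y
  transitive⇒injective transitive {x} {y} x<P y<P hx≡hy
    with m , hᵐx≡y ← transitive x x<P y y<P = from-time (m % P) refl
    where
    instance
      P≢0 : NonZero P
      P≢0 = >-nonZero (≤-<-trans z≤n x<P)
    y≡fold-m%P : fold x h (m % P) ≡ y
    y≡fold-m%P = trans (sym (fold-periodic-% h P (transitive⇒period transitive x<P) m)) hᵐx≡y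
    from-time : ∀ t → t ≡ m % P → x ≡ y
    from-time zero    t≡ = trans (cong (fold x h) t≡) y≡fold-m%P
    from-time (suc t) t≡ = contradiction (covering-period-≥ (transitive (h x) (h-< x x<P)) (suc t) z<s hx-period) (<⇒≱ t<P)
      where
      t<P : suc t < P
      t<P = subst (_< P) (sym t≡) (m%n<n m P)
      hx-period : fold (h x) h (suc t) ≡ h x
      hx-period = begin
        fold (h x) h (suc t)  ≡⟨ fold-suc h x (suc t) ⟨
        h (fold x h (suc t))  ≡⟨ cong (λ i → h (fold x h i)) t≡ ⟩
        h (fold x h (m % P))  ≡⟨ cong h y≡fold-m%P ⟩
        h y                   ≡⟨ hx≡hy ⟨
        h x                   ∎
        where open ≡-Reasoning

^-mod-square : ∀ {n X a} j → X ≡ 1 + n * a [mod n * n ] → X ^ j ≡ 1 + n * (a * j) [mod n * n ]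
^-mod-square {n} {X} {a} zero    _ = mod-reflexive (expand₀ n a)
  where
  expand₀ : ∀ n a → 1 ≡ 1 + n * (a * 0)
  expand₀ = solve-∀
^-mod-square {n} {X} {a} (suc j) X≡ = begin
  X * X ^ j                                        ≈⟨ *-cong-mod X≡ (^-mod-square {n} {X} {a} j X≡) ⟩
  (1 + n * a) * (1 + n * (a * j))                  ≡⟨ expand n a j ⟩
  1 + n * (a * suc j) + n * n * (a * (a * j))      ≈⟨ +-congˡ-mod _ (n*x≡0-mod (a * (a * j))) ⟩
  1 + n * (a * suc j) + 0                          ≡⟨ +-identityʳ _ ⟩
  1 + n * (a * suc j)                              ∎
  where
  open ModReasoning (n * n)
  expand : ∀ n a j → (1 + n * a) * (1 + n * (a * j)) ≡ 1 + n * (a * suc j) + n * n * (a * (a * j))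
  expand = solve-∀

triangular : ℕ → ℕ
triangular zero    = 0
triangular (suc j) = triangular j + j

triangular*2 : ∀ j → triangular j * 2 + j ≡ j * j
triangular*2 zero    = refl
triangular*2 (suc j) = step (triangular j) (triangular*2 j)
  where
  open ≡-Reasoning
  step : ∀ T → T * 2 + j ≡ j * j → (T + j) * 2 + suc j ≡ suc j * suc j
  step T hyp = begin
    (T + j) * 2 + suc j        ≡⟨ solve (T ∷ j ∷ []) ⟩
    (T * 2 + j) + (2 * j + 1)  ≡⟨ cong (_+ (2 * j + 1)) hyp ⟩
    j * j + (2 * j + 1)        ≡⟨ solve (j ∷ []) ⟩
    suc j * suc j              ∎

-- geometric e E j = e (1 + E + ⋯ + E^{j−1})
geometric : ℕ → ℕ → ℕ → ℕ
geometric e E zero    = 0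
geometric e E (suc j) = e + geometric e E j * E

geometric-mod-square : ∀ {n E a} e j → E ≡ 1 + n * a [mod n * n ] →
                       geometric e E j ≡ e * j + e * (n * a) * triangular j [mod n * n ]
geometric-mod-square {n} {E} {a} e zero    _ = mod-reflexive (expand₀ e (e * (n * a)))
  where
  expand₀ : ∀ e c → 0 ≡ e * 0 + c * 0
  expand₀ = solve-∀
geometric-mod-square {n} {E} {a} e (suc j) E≡ = begin
  e + geometric e E j * E                                          ≈⟨ +-congˡ-mod e (*-cong-mod (geometric-mod-square {n} {E} {a} e j E≡) E≡) ⟩
  e + (e * j + e * (n * a) * T) * (1 + n * a)                      ≡⟨ expand e j n a T ⟩
  e * suc j + e * (n * a) * (T + j) + n * n * (e * a * a * T)      ≈⟨ +-congˡ-mod _ (n*x≡0-mod (e * a * a * T)) ⟩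
  e * suc j + e * (n * a) * (T + j) + 0                            ≡⟨ +-identityʳ _ ⟩
  e * suc j + e * (n * a) * (T + j)                                ∎
  where
  open ModReasoning (n * n)
  T : ℕ
  T = triangular j
  expand : ∀ e j n a T → e + (e * j + e * (n * a) * T) * (1 + n * a) ≡
                         e * suc j + e * (n * a) * (T + j) + n * n * (e * a * a * T)
  expand = solve-∀

∣-triangular*2 : ∀ n → n ∣ triangular n * 2
∣-triangular*2 n = ∣m+n∣m⇒∣n (subst (n ∣_) n*n≡n+T*2 (m∣m*n n)) ∣-refl
  where
  n*n≡n+T*2 : n * n ≡ n + triangular n * 2
  n*n≡n+T*2 = trans (sym (triangular*2 n)) (+-comm (triangular n * 2) n)

module _ {p : ℕ} (pr : Prime p) .{{_ : NonZero p}} where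

  prime>1 : 1 < p
  prime>1 = nonTrivial⇒n>1 p {{prime⇒nonTrivial pr}}

  1+[p∸1]≡p : 1 + (p ∸ 1) ≡ p
  1+[p∸1]≡p = m+[n∸m]≡n (<⇒≤ prime>1)

  inverse-mod : ∀ {c} → ¬ (c ≡ 0 [mod p ]) → ∃ λ u → u * c ≡ 1 [mod p ]
  inverse-mod {c} c≢0 = invert (coprime-Bézout (prime⇒coprime pr {{c%p≢0}} (m%n<n c p)))
    where
    c%p≢0 : NonZero (c % p)
    c%p≢0 = ≢-nonZero (λ c%p≡0 → c≢0 (mod-trans (mod-sym (%-mod c)) (mod-reflexive c%p≡0)))
    invert : Bézout.Identity 1 p (c % p) → ∃ λ u → u * c ≡ 1 [mod p ]
    invert (Bézout.-+ x y eq) = y , (begin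
      y * c        ≈⟨ *-congˡ-mod y (%-mod c) ⟨
      y * (c % p)  ≡⟨ eq ⟨
      1 + x * p    ≈⟨ +-congˡ-mod 1 (x*n≡0-mod x) ⟩
      1 + 0        ∎)
      where open ModReasoning p
    invert (Bézout.+- x y eq) = (p ∸ 1) * y , (begin
      (p ∸ 1) * y * c          ≈⟨ *-congˡ-mod ((p ∸ 1) * y) (%-mod c) ⟨
      (p ∸ 1) * y * (c % p)    ≡⟨ *-assoc (p ∸ 1) y (c % p) ⟩
      (p ∸ 1) * (y * (c % p))  ≈⟨ ≡-1⇒*≡1-mod 1+[p∸1]≡p y*c+1≡0 ⟩
      1                        ∎)
      where
      open ModReasoning p
      y*c+1≡0 : y * (c % p) + 1 ≡ 0 [mod p ]
      y*c+1≡0 = begin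
        y * (c % p) + 1  ≡⟨ +-comm (y * (c % p)) 1 ⟩
        1 + y * (c % p)  ≡⟨ eq ⟩
        x * p            ≈⟨ x*n≡0-mod x ⟩
        0                ∎

  -- t = −e (E − 1)⁻¹, with q = p − 1 standing for −1.
  affine-fixed-point : ∀ {E} → ¬ (E ≡ 1 [mod p ]) → ∀ e → ∃ λ t → e + t * E ≡ t [mod p ]
  affine-fixed-point {E} E≢1 e = fixed-point (p ∸ 1) 1+[p∸1]≡p
    where
    fixed-point : ∀ q → 1 + q ≡ p → ∃ λ t → e + t * E ≡ t [mod p ]
    fixed-point q 1+q≡p = solution (inverse-mod E-1≢0)
      where
      E-1≢0 : ¬ (E + q ≡ 0 [mod p ])
      E-1≢0 E+q≡0 = E≢1 (+-cancelʳ-mod q (mod-trans E+q≡0 (mod-sym (subst (_≡ 0 [mod p ]) (sym 1+q≡p) n≡0-mod))))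
      solution : (∃ λ u → u * (E + q) ≡ 1 [mod p ]) → ∃ λ t → e + t * E ≡ t [mod p ]
      solution (u , u*[E-1]≡1) = u * (e * q) , +-cancelʳ-mod (u * (e * q) * q) (begin
        e + u * (e * q) * E + u * (e * q) * q  ≡⟨ solve (e ∷ u ∷ E ∷ q ∷ []) ⟩
        e + e * q * (u * (E + q))              ≈⟨ +-congˡ-mod e (*-congˡ-mod (e * q) u*[E-1]≡1) ⟩
        e + e * q * 1                          ≡⟨ solve (e ∷ q ∷ []) ⟩
        e * (1 + q)                            ≡⟨ cong (e *_) 1+q≡p ⟩
        e * p                                  ≈⟨ x*n≡0-mod e ⟩
        0                                      ≈⟨ x*n≡0-mod (u * (e * q)) ⟨
        u * (e * q) * p                        ≡⟨ cong (u * (e * q) *_) 1+q≡p ⟨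
        u * (e * q) * (1 + q)                  ≡⟨ solve (u ∷ e ∷ q ∷ []) ⟩
        u * (e * q) + u * (e * q) * q          ∎)
        where open ModReasoning p

  odd-prime-∣-triangular : p ≢ 2 → p ∣ triangular p
  odd-prime-∣-triangular p≢2 with euclidsLemma (triangular p) 2 pr (∣-triangular*2 p)
  ... | inj₁ p∣T = p∣T
  ... | inj₂ p∣2 = contradiction (≤-antisym (∣⇒≤ p∣2) prime>1) p≢2

  -- The triangular term of the geometric sum vanishes: for odd p because p ∣ p(p − 1)/2, for p = 2 because 2 ∣ a.
  geometric-mod-p² : ∀ {E a} → E ≡ 1 + p * a [mod p * p ] → (p ≡ 2 → a ≡ 0 [mod p ]) →
                     ∀ e → geometric e E p ≡ e * p [mod p * p ]
  geometric-mod-p² {E} {a} E≡1+pa p≡2⇒a≡0 e = begin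
    geometric e E p                        ≈⟨ geometric-mod-square {p} {E} {a} e p E≡1+pa ⟩
    e * p + e * (p * a) * triangular p     ≈⟨ +-congˡ-mod (e * p) (vanishes (p ≟ 2)) ⟩
    e * p + 0                              ≡⟨ +-identityʳ (e * p) ⟩
    e * p                                  ∎
    where
    open ModReasoning (p * p)
    regroupᵃ : ∀ e p q T → e * (p * (q * p)) * T ≡ p * p * (e * q * T)
    regroupᵃ = solve-∀
    regroupᵀ : ∀ e p a q → e * (p * a) * (q * p) ≡ p * p * (e * a * q)
    regroupᵀ = solve-∀
    vanishes : Dec (p ≡ 2) → e * (p * a) * triangular p ≡ 0 [mod p * p ]
    vanishes (yes p≡2) with divides q a≡q*p ← mod-0⇒∣ (p≡2⇒a≡0 p≡2) =
      subst (λ a → e * (p * a) * triangular p ≡ 0 [mod p * p ]) (sym a≡q*p)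
            (subst (_≡ 0 [mod p * p ]) (sym (regroupᵃ e p q (triangular p))) (n*x≡0-mod (e * q * triangular p)))
    vanishes (no p≢2) with divides q T≡q*p ← odd-prime-∣-triangular p≢2 =
      subst (λ T → e * (p * a) * T ≡ 0 [mod p * p ]) (sym T≡q*p)
            (subst (_≡ 0 [mod p * p ]) (sym (regroupᵀ e p a q)) (n*x≡0-mod (e * a * q)))

module _ {p : ℕ} .{{_ : NonZero p}} where

  seq-mod : (y : ℤp p) → ∀ {j m} → j ≤ m → seq y m ≡ seq y j [mod p ^ j ]
  seq-mod y {j} j≤m = subst (λ m → seq y m ≡ seq y j [mod p ^ j ]) (m∸n+n≡m j≤m) (from-above _)
    where
    from-above : ∀ d → seq y (d + j) ≡ seq y j [mod p ^ j ]
    from-above zero    = mod-refl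
    from-above (suc d) = mod-trans (mod-weaken-^ p (m≤n+m j d) (mod-trans (mod-sym (%-mod {{m^n≢0 p (d + j)}} _)) (mod-reflexive (coh y (d + j)))))
                                   (from-above d)

  ι-+ : ∀ x y → _≈_ p (ι p (x + y)) (_⊕_ p (ι p x) (ι p y))
  ι-+ x y k = %-distribˡ-+ x y (p ^ k) {{m^n≢0 p k}}

  p^[2+k]≡p²*p^k : ∀ k → p ^ (2 + k) ≡ p ^ 2 * p ^ k
  p^[2+k]≡p²*p^k = ^-distribˡ-+-* p 2

module Ergodicity {p : ℕ} (pr : Prime p) .{{_ : NonZero p}}
                  (f : ℤp p → ℤp p) (f-resp : Respects≈ p f)
                  {N : ℕ} (ud : UDIntWith p 2 f N) where

  F : ℕ → ℕ → ℕ
  F = reduce p f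

  F-< : ∀ m x → F m x < p ^ m
  F-< m x = seq< (f (ι p x)) m

  F-mod : ∀ {j m} → j ≤ m → ∀ x → F m x ≡ F j x [mod p ^ j ]
  F-mod j≤m x = seq-mod (f (ι p x)) j≤m

  δ : ℕ → ℕ
  δ x = seq (proj₁ ud (ι p x)) 2

  δ-< : ∀ x → δ x < p ^ 2
  δ-< x = seq< (proj₁ ud (ι p x)) 2

  F-expansion : ∀ {K} → N ≤ K → ∀ x t →
                F (2 + K) (x + p ^ K * t) ≡ F (2 + K) x + p ^ K * (t * δ x) [mod p ^ (2 + K) ]
  F-expansion {K} N≤K x t = begin
    F (2 + K) (x + P * t)                          ≡⟨ f-resp _ _ (ι-+ x (P * t)) (2 + K) ⟩
    seq (f (_⊕_ p (ι p x) h)) (2 + K)              ≡⟨ proj₂ ud K N≤K (ι p x) h h≡0 ⟩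
    (F (2 + K) x + (seq h (2 + K) * d) % Q) % Q    ≈⟨ %-mod _ ⟩
    F (2 + K) x + (seq h (2 + K) * d) % Q          ≈⟨ +-congˡ-mod _ (%-mod _) ⟩
    F (2 + K) x + (P * t) % Q * d                  ≈⟨ +-congˡ-mod _ (*-congʳ-mod d (%-mod (P * t))) ⟩
    F (2 + K) x + P * t * d                        ≡⟨ cong (F (2 + K) x +_) (*-assoc P t d) ⟩
    F (2 + K) x + P * (t * d)                      ≈⟨ +-congˡ-mod _ (mod-≡ (sym (p^[2+k]≡p²*p^k K)) d-scaled) ⟩
    F (2 + K) x + P * (t * δ x)                    ∎
    where
    open ModReasoning (p ^ (2 + K))
    instance
      p^K≢0 : NonZero (p ^ K)
      p^K≢0 = m^n≢0 p K
      p^[2+K]≢0 : NonZero (p ^ (2 + K))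
      p^[2+K]≢0 = m^n≢0 p (2 + K)
    P Q : ℕ
    P = p ^ K
    Q = p ^ (2 + K)
    h : ℤp p
    h = ι p (P * t)
    h≡0 : seq h K ≡ 0
    h≡0 = trans (cong (_% P) (*-comm P t)) (m*n%n≡0 t P)
    d : ℕ
    d = seq (proj₁ ud (ι p x)) (2 + K)
    d-scaled : P * (t * d) ≡ P * (t * δ x) [mod p ^ 2 * P ]
    d-scaled = *-scale-mod P (*-congˡ-mod t (seq-mod (proj₁ ud (ι p x)) (m≤m+n 2 K)))

  F-cong : ∀ {m} → N ≤ m → ∀ {x y} → x ≡ y [mod p ^ m ] → F m x ≡ F m y
  F-cong {m} N≤m {x} {y} (mod-by k l e) = trans (sym (F-shift x k)) (trans (cong (F m) e) (F-shift y l))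
    where
    F-shift : ∀ x t → F m (x + p ^ m * t) ≡ F m x
    F-shift x t = mod⇒≡ (F-< m _) (F-< m x) (begin
      F m (x + p ^ m * t)                      ≈⟨ F-mod (m≤n+m m 2) _ ⟨
      F (2 + m) (x + p ^ m * t)                ≈⟨ mod-weaken-^ p (m≤n+m m 2) (F-expansion N≤m x t) ⟩
      F (2 + m) x + p ^ m * (t * δ x)          ≈⟨ +-congˡ-mod _ (n*x≡0-mod (t * δ x)) ⟩
      F (2 + m) x + 0                          ≡⟨ +-identityʳ _ ⟩
      F (2 + m) x                              ≈⟨ F-mod (m≤n+m m 2) x ⟩
      F m x                                    ∎)
      where open ModReasoning (p ^ m)

  -- Expanding f(x + pᴺ(t + 1)) directly and in two steps gives pᴺ δ(x) ≡ pᴺ δ(x + pᴺ t) (mod p^{N+2}).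
  δ-cong : ∀ {x y} → x ≡ y [mod p ^ N ] → δ x ≡ δ y
  δ-cong {x} {y} (mod-by k l e) = trans (sym (δ-shift x k)) (trans (cong δ e) (δ-shift y l))
    where
    instance
      p^N≢0 : NonZero (p ^ N)
      p^N≢0 = m^n≢0 p N
    P : ℕ
    P = p ^ N
    regroup : ∀ a P t d → a + P * (t * d) + P * d ≡ a + P * (suc t * d)
    regroup = solve-∀
    split-step : ∀ x P t → x + P * suc t ≡ x + P * t + P * 1
    split-step = solve-∀
    δ-shift : ∀ x t → δ (x + P * t) ≡ δ x
    δ-shift x t = mod⇒≡ (δ-< _) (δ-< x) (mod-sym (shift-cancel-mod (p ^ 2) (mod-≡ (p^[2+k]≡p²*p^k N) (begin
      c + P * δ x                               ≡⟨ regroup (F (2 + N) x) P t (δ x) ⟩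
      F (2 + N) x + P * (suc t * δ x)           ≈⟨ F-expansion ≤-refl x (suc t) ⟨
      F (2 + N) (x + P * suc t)                 ≡⟨ cong (F (2 + N)) (split-step x P t) ⟩
      F (2 + N) (x + P * t + P * 1)             ≈⟨ F-expansion ≤-refl (x + P * t) 1 ⟩
      F (2 + N) (x + P * t) + P * (1 * δ a)     ≈⟨ +-cong-mod (F-expansion ≤-refl x t) mod-refl ⟩
      c + P * (1 * δ a)                         ≡⟨ cong (λ z → c + P * z) (*-identityˡ (δ a)) ⟩
      c + P * δ a                               ∎))))
      where
      open ModReasoning (p ^ (2 + N))
      a c : ℕ
      a = x + P * t
      c = F (2 + N) x + P * (t * δ x)

  F-iter-cong : ∀ {m} → N ≤ m → ∀ n {x y} → x ≡ y [mod p ^ m ] → fold x (F m) n ≡ fold y (F m) n [mod p ^ m ]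
  F-iter-cong N≤m zero    x≡y = x≡y
  F-iter-cong N≤m (suc n) x≡y = mod-reflexive (F-cong N≤m (F-iter-cong N≤m n x≡y))

  F-iter-mod : ∀ {j m} → N ≤ j → j ≤ m → ∀ n x → fold x (F m) n ≡ fold x (F j) n [mod p ^ j ]
  F-iter-mod N≤j j≤m zero    x = mod-refl
  F-iter-mod N≤j j≤m (suc n) x = mod-trans (F-mod j≤m _) (mod-reflexive (F-cong N≤j (F-iter-mod N≤j j≤m n x)))

  -- Chain rule: the derivative of fⁿ at x modulo p², computed along the orbit of x modulo pᴺ.
  δ-iter : ℕ → ℕ → ℕ
  δ-iter zero    x = 1
  δ-iter (suc n) x = δ-iter n x * δ (fold x (F N) n)

  δ-iter-+ : ∀ m n x → δ-iter (m + n) x ≡ δ-iter n x * δ-iter m (fold x (F N) n)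
  δ-iter-+ zero    n x = sym (*-identityʳ (δ-iter n x))
  δ-iter-+ (suc m) n x = begin
    δ-iter (m + n) x * δ (fold x (F N) (m + n))     ≡⟨ cong₂ _*_ (δ-iter-+ m n x) (cong δ (fold-+ x (F N) m)) ⟩
    δ-iter n x * δ-iter m y * δ (fold y (F N) m)    ≡⟨ *-assoc (δ-iter n x) _ _ ⟩
    δ-iter n x * (δ-iter m y * δ (fold y (F N) m))  ∎
    where
    open ≡-Reasoning
    y : ℕ
    y = fold x (F N) n

  δ-iter-cong : ∀ n {x y} → x ≡ y [mod p ^ N ] → δ-iter n x ≡ δ-iter n y
  δ-iter-cong zero    x≡y = refl
  δ-iter-cong (suc n) x≡y = cong₂ _*_ (δ-iter-cong n x≡y) (δ-cong (F-iter-cong ≤-refl n x≡y))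

  iter-expansion : ∀ {K} → N ≤ K → ∀ n x t →
                   fold (x + p ^ K * t) (F (2 + K)) n ≡ fold x (F (2 + K)) n + p ^ K * (t * δ-iter n x) [mod p ^ (2 + K) ]
  iter-expansion {K} N≤K zero    x t = mod-reflexive (cong (λ s → x + p ^ K * s) (sym (*-identityʳ t)))
  iter-expansion {K} N≤K (suc n) x t = begin
    F (2 + K) (fold (x + P * t) (F (2 + K)) n)       ≡⟨ F-cong N≤2+K (iter-expansion N≤K n x t) ⟩
    F (2 + K) (y + P * (t * δ-iter n x))             ≈⟨ F-expansion N≤K y (t * δ-iter n x) ⟩
    F (2 + K) y + P * (t * δ-iter n x * δ y)         ≡⟨ cong (λ d → F (2 + K) y + P * (t * δ-iter n x * d)) δy≡ ⟩
    F (2 + K) y + P * (t * δ-iter n x * δ yᴺ)        ≡⟨ cong (λ s → F (2 + K) y + P * s) (*-assoc t (δ-iter n x) _) ⟩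
    F (2 + K) y + P * (t * δ-iter (suc n) x)         ∎
    where
    open ModReasoning (p ^ (2 + K))
    P y yᴺ : ℕ
    P = p ^ K
    y = fold x (F (2 + K)) n
    yᴺ = fold x (F N) n
    N≤2+K : N ≤ 2 + K
    N≤2+K = ≤-trans N≤K (m≤n+m K 2)
    δy≡ : δ y ≡ δ yᴺ
    δy≡ = δ-cong (F-iter-mod ≤-refl N≤2+K n x)

  iter≡fold : ∀ (g : ℕ → ℕ) n x → iter p g n x ≡ fold x g n
  iter≡fold g zero    x = refl
  iter≡fold g (suc n) x = cong g (iter≡fold g n x)

  module Orbits (K : ℕ) = SingleOrbit (F K) (p ^ K) (λ x _ → F-< K x)

  transitive⇒covers : ∀ {K} → TransitiveMod p f K → Orbits.Transitive K
  transitive⇒covers (_ , orbit) w w<P y y<P with n , fⁿw≡y ← orbit w y w<P y<P = n , trans (sym (iter≡fold _ n w)) fⁿw≡y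

  covers⇒transitive : ∀ {K} → Orbits.Transitive K → TransitiveMod p f K
  covers⇒transitive {K} covers = (λ x y → Orbits.transitive⇒injective K covers) , orbit
    where
    orbit : ∀ x y → x < p ^ K → y < p ^ K → ∃ λ n → iter p (F K) n x ≡ y
    orbit x y x<P y<P with n , fⁿx≡y ← covers x x<P y y<P = n , trans (iter≡fold _ n x) fⁿx≡y

  p^K<p^[1+K] : ∀ K → p ^ K < p ^ suc K
  p^K<p^[1+K] K = ^-monoʳ-< p (prime>1 pr) (n<1+n K)

  transitive-descends : ∀ {K} → N ≤ K → TransitiveMod p f (suc K) → TransitiveMod p f K
  transitive-descends {K} N≤K tr = covers⇒transitive covers
    where
    covers : Orbits.Transitive K
    covers w w<P y y<P with n , fⁿw≡y ← transitive⇒covers tr w (<-trans w<P (p^K<p^[1+K] K)) y (<-trans y<P (p^K<p^[1+K] K)) =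
      n , mod⇒≡ (Orbits.fold-< K n w<P) y<P
                (mod-trans (mod-sym (F-iter-mod N≤K (n≤1+n K) n w)) (mod-weaken p (mod-reflexive fⁿw≡y)))

  Returns : ℕ → Set
  Returns K = ∀ z → fold z (F K) (p ^ K) ≡ z [mod p ^ K ]

  Escapes : ℕ → Set
  Escapes K = ∀ z → ¬ (fold z (F (suc K)) (p ^ K) ≡ z [mod p ^ suc K ])

  CycleMultiplier≡1 : ℕ → ℕ → Set
  CycleMultiplier≡1 m K = ∀ z → δ-iter (p ^ K) z ≡ 1 [mod m ]

  transitive⇒returns : ∀ {K} → N ≤ K → TransitiveMod p f K → Returns K
  transitive⇒returns {K} N≤K tr z = begin
    fold z (F K) (p ^ K)              ≈⟨ F-iter-cong N≤K (p ^ K) (%-mod z) ⟨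
    fold (z % p ^ K) (F K) (p ^ K)    ≡⟨ Orbits.transitive⇒period K (transitive⇒covers tr) (m%n<n z (p ^ K)) ⟩
    z % p ^ K                         ≈⟨ %-mod z ⟩
    z                                 ∎
    where
    open ModReasoning (p ^ K)
    instance
      p^K≢0 : NonZero (p ^ K)
      p^K≢0 = m^n≢0 p K

  transitive⇒escapes : ∀ {K} → N ≤ K → TransitiveMod p f (suc K) → Escapes K
  transitive⇒escapes {K} N≤K tr z returns =
    <⇒≱ (p^K<p^[1+K] K) (Orbits.covering-period-≥ (suc K) (transitive⇒covers tr z₀ z₀<) (p ^ K) (m^n>0 p K) z₀-returns)
    where
    instance
      p^[1+K]≢0 : NonZero (p ^ suc K)
      p^[1+K]≢0 = m^n≢0 p (suc K)
    z₀ : ℕ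
    z₀ = z % p ^ suc K
    z₀< : z₀ < p ^ suc K
    z₀< = m%n<n z (p ^ suc K)
    z₀-returns : fold z₀ (F (suc K)) (p ^ K) ≡ z₀
    z₀-returns = mod⇒≡ (Orbits.fold-< (suc K) (p ^ K) z₀<) z₀< (begin
      fold z₀ (F (suc K)) (p ^ K)   ≈⟨ F-iter-cong (m≤n⇒m≤1+n N≤K) (p ^ K) (%-mod z) ⟩
      fold z (F (suc K)) (p ^ K)    ≈⟨ returns ⟩
      z                             ≈⟨ %-mod z ⟨
      z₀                            ∎)
      where open ModReasoning (p ^ suc K)

  module AboveN {K : ℕ} (N≤K : N ≤ K) where

    private
      P : ℕ
      P = p ^ K
      g₁ g₂ : ℕ → ℕ
      g₁ = F (suc K)
      g₂ = F (2 + K)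
      instance
        P≢0 : NonZero P
        P≢0 = m^n≢0 p K
      N≤1+K : N ≤ suc K
      N≤1+K = m≤n⇒m≤1+n N≤K

    iter-expansion₁ : ∀ n x t → fold (x + P * t) g₁ n ≡ fold x g₁ n + P * (t * δ-iter n x) [mod p * P ]
    iter-expansion₁ n x t = begin
      fold (x + P * t) g₁ n                  ≈⟨ F-iter-mod N≤1+K (n≤1+n _) n _ ⟨
      fold (x + P * t) g₂ n                  ≈⟨ mod-weaken p (iter-expansion N≤K n x t) ⟩
      fold x g₂ n + P * (t * δ-iter n x)     ≈⟨ +-cong-mod (F-iter-mod N≤1+K (n≤1+n _) n x) mod-refl ⟩
      fold x g₁ n + P * (t * δ-iter n x)     ∎
      where open ModReasoning (p * P)

    returns-below : Returns K → ∀ w → fold w (F N) P ≡ w [mod p ^ N ]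
    returns-below returns w = mod-trans (mod-sym (F-iter-mod ≤-refl N≤K P w)) (mod-weaken-^ p N≤K (returns w))

    return-shift : Returns K → ∀ w → ∃ λ c → fold w g₁ P ≡ w + P * c [mod p * P ]
    return-shift returns w = mod-lift p (mod-sym (mod-trans (F-iter-mod N≤K (n≤1+n K) P w) (returns w)))

    return-shift-≢0 : Escapes K → ∀ {w c} → fold w g₁ P ≡ w + P * c [mod p * P ] → ¬ (c ≡ 0 [mod p ])
    return-shift-≢0 escapes {w} shift c≡0 = escapes w (mod-trans shift (shift-vanish-mod P c≡0))

    return-iterate : CycleMultiplier≡1 p K → ∀ {w c} → fold w g₁ P ≡ w + P * c [mod p * P ] →
                     ∀ j → fold w g₁ (j * P) ≡ w + P * (j * c) [mod p * P ]
    return-iterate unit {w} {c} shift zero    = mod-reflexive (sym (x+n*0≡x w P))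
    return-iterate unit {w} {c} shift (suc j) = begin
      fold w g₁ (P + j * P)                        ≡⟨ fold-+ w g₁ P ⟩
      fold (fold w g₁ (j * P)) g₁ P                ≈⟨ F-iter-cong N≤1+K P (return-iterate unit shift j) ⟩
      fold (w + P * (j * c)) g₁ P                  ≈⟨ iter-expansion₁ P w (j * c) ⟩
      fold w g₁ P + P * (j * c * δ-iter P w)       ≈⟨ +-cong-mod shift (*-scale-mod P jc*E≡jc) ⟩
      w + P * c + P * (j * c)                      ≡⟨ +-*-distrib w P c (j * c) ⟩
      w + P * (c + j * c)                          ∎
      where
      open ModReasoning (p * P)
      jc*E≡jc : j * c * δ-iter P w ≡ j * c [mod p ]
      jc*E≡jc = mod-trans (*-congˡ-mod (j * c) (unit w)) (mod-reflexive (*-identityʳ (j * c)))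

    -- Otherwise a fixed point t of t ↦ e + t δ-iter P z gives a point z + P t returning after P steps.
    multiplier-unit : Returns K → Escapes K → CycleMultiplier≡1 p K
    multiplier-unit returns escapes z = decidable-stable (mod? E 1) λ E≢1 →
      let e , shift = return-shift returns z
          t , fixed = affine-fixed-point pr E≢1 e
      in escapes (z + P * t) (begin
        fold (z + P * t) g₁ P              ≈⟨ iter-expansion₁ P z t ⟩
        fold z g₁ P + P * (t * E)          ≈⟨ +-cong-mod shift mod-refl ⟩
        z + P * e + P * (t * E)            ≡⟨ +-*-distrib z P e (t * E) ⟩
        z + P * (e + t * E)                ≈⟨ +-congˡ-mod z (*-scale-mod P fixed) ⟩
        z + P * t                          ∎)
      where
      open ModReasoning (p * P)
      E : ℕ
      E = δ-iter P z

    -- Walk along the fibre above z in steps of P iterations, each adding P c with c invertible.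
    fibre-walk : Returns K → Escapes K → ∀ {z y} → z ≡ y [mod P ] → ∃ λ m → fold z g₁ m ≡ y [mod p * P ]
    fibre-walk returns escapes {z} {y} z≡y =
      let t , y≡z+Pt = mod-lift p z≡y
          c , shift = return-shift returns z
          u , u*c≡1 = inverse-mod pr (return-shift-≢0 escapes shift)
      in u * t * P , (begin
        fold z g₁ (u * t * P)     ≈⟨ return-iterate (multiplier-unit returns escapes) shift (u * t) ⟩
        z + P * (u * t * c)       ≈⟨ +-congˡ-mod z (*-scale-mod P (inverse-cancel-mod {p} {u} {c} t u*c≡1)) ⟩
        z + P * t                 ≈⟨ y≡z+Pt ⟨
        y                         ∎)
      where open ModReasoning (p * P)

    transitive-step : TransitiveMod p f K → Escapes K → TransitiveMod p f (suc K)
    transitive-step tr escapes = covers⇒transitive covers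
      where
      lift-orbit : ∀ {x y} n → fold (x % P) (F K) n ≡ y % P → fold x g₁ n ≡ y [mod P ]
      lift-orbit {x} {y} n fⁿ[x%P]≡y%P = begin
        fold x g₁ n             ≈⟨ F-iter-mod N≤K (n≤1+n K) n x ⟩
        fold x (F K) n          ≈⟨ F-iter-cong N≤K n (%-mod x) ⟨
        fold (x % P) (F K) n    ≡⟨ fⁿ[x%P]≡y%P ⟩
        y % P                   ≈⟨ %-mod y ⟩
        y                       ∎
        where open ModReasoning P
      covers : Orbits.Transitive (suc K)
      covers x x<pP y y<pP =
        let n , fⁿ[x%P]≡y%P = transitive⇒covers tr (x % P) (m%n<n x P) (y % P) (m%n<n y P)
            m , fᵐ⁺ⁿx≡y = fibre-walk (transitive⇒returns N≤K tr) escapes (lift-orbit n fⁿ[x%P]≡y%P)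
        in m + n , (begin
          fold x g₁ (m + n)          ≡⟨ fold-+ x g₁ m ⟩
          fold (fold x g₁ n) g₁ m    ≡⟨ mod⇒≡ (Orbits.fold-< (suc K) m (Orbits.fold-< (suc K) n x<pP)) y<pP fᵐ⁺ⁿx≡y ⟩
          y                          ∎)
        where open ≡-Reasoning

    δ-iter-power : Returns K → ∀ j z → δ-iter (j * P) z ≡ δ-iter P z ^ j
    δ-iter-power returns zero    z = refl
    δ-iter-power returns (suc j) z = begin
      δ-iter (P + j * P) z                                 ≡⟨ δ-iter-+ P (j * P) z ⟩
      δ-iter (j * P) z * δ-iter P (fold z (F N) (j * P))   ≡⟨ cong₂ _*_ (δ-iter-power returns j z) (δ-iter-cong P (returnsᴺ j)) ⟩
      δ-iter P z ^ j * δ-iter P z                          ≡⟨ *-comm (δ-iter P z ^ j) _ ⟩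
      δ-iter P z ^ suc j                                   ∎
      where
      open ≡-Reasoning
      returnsᴺ : ∀ j → fold z (F N) (j * P) ≡ z [mod p ^ N ]
      returnsᴺ zero    = mod-refl
      returnsᴺ (suc j) = mod-trans (mod-reflexive (fold-+ z (F N) P))
                           (mod-trans (F-iter-cong ≤-refl P (returnsᴺ j)) (returns-below returns z))

    multiplier-unit² : Returns K → CycleMultiplier≡1 p K → CycleMultiplier≡1 (p * p) (suc K)
    multiplier-unit² returns unit z = begin
      δ-iter (p * P) z       ≡⟨ δ-iter-power returns p z ⟩
      δ-iter P z ^ p         ≈⟨ ^-mod-square {p} {δ-iter P z} {a} p E≡1+pa ⟩
      1 + p * (a * p)        ≡⟨ cong (1 +_) (regroup p a) ⟩
      1 + p * p * a          ≈⟨ +-congˡ-mod 1 (n*x≡0-mod a) ⟩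
      1 + 0                  ∎
      where
      open ModReasoning (p * p)
      regroup : ∀ p a → p * (a * p) ≡ p * p * a
      regroup = solve-∀
      a : ℕ
      a = proj₁ (mod-lift p (mod-sym (unit z)))
      E≡1+pa : δ-iter P z ≡ 1 + p * a [mod p * p ]
      E≡1+pa = proj₂ (mod-lift p (mod-sym (unit z)))

    return-shift₂ : Returns K → Escapes K → ∀ w →
                    ∃ λ e → ¬ (e ≡ 0 [mod p ]) × fold w g₂ P ≡ w + P * e [mod p * (p * P) ]
    return-shift₂ returns escapes w = e , e≢0 , mod-≡ (*-assoc p p P) shift
      where
      instance
        p*p≢0 : NonZero (p * p)
        p*p≢0 = m*n≢0 p p
      lifted : ∃ λ e → fold w g₂ P ≡ w + P * e [mod p * p * P ]
      lifted = mod-lift (p * p) (mod-sym (mod-trans (F-iter-mod N≤K (m≤n+m K 2) P w) (returns w)))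
      e : ℕ
      e = proj₁ lifted
      shift : fold w g₂ P ≡ w + P * e [mod p * p * P ]
      shift = proj₂ lifted
      e≢0 : ¬ (e ≡ 0 [mod p ])
      e≢0 e≡0 = escapes w (begin
        fold w g₁ P        ≈⟨ F-iter-mod N≤1+K (n≤1+n (suc K)) P w ⟨
        fold w g₂ P        ≈⟨ mod-weaken p (mod-≡ (*-assoc p p P) shift) ⟩
        w + P * e          ≈⟨ shift-vanish-mod P e≡0 ⟩
        w                  ∎)
        where open ModReasoning (p * P)

    geometric-iterate : ∀ {w e} → fold w g₂ P ≡ w + P * e [mod p * (p * P) ] →
                        ∀ j → fold w g₂ (j * P) ≡ w + P * geometric e (δ-iter P w) j [mod p * (p * P) ]
    geometric-iterate {w} {e} shift zero    = mod-reflexive (sym (x+n*0≡x w P))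
    geometric-iterate {w} {e} shift (suc j) = begin
      fold w g₂ (P + j * P)                        ≡⟨ fold-+ w g₂ P ⟩
      fold (fold w g₂ (j * P)) g₂ P                ≈⟨ F-iter-cong (≤-trans N≤K (m≤n+m K 2)) P (geometric-iterate shift j) ⟩
      fold (w + P * G) g₂ P                        ≈⟨ iter-expansion N≤K P w G ⟩
      fold w g₂ P + P * (G * E)                    ≈⟨ +-cong-mod shift mod-refl ⟩
      w + P * e + P * (G * E)                      ≡⟨ +-*-distrib w P e (G * E) ⟩
      w + P * (e + G * E)                          ∎
      where
      open ModReasoning (p * (p * P))
      E G : ℕ
      E = δ-iter P w
      G = geometric e E j

    -- After p·P steps the point moves by P·e·(1 + E + ⋯ + E^{p−1}) ≡ P·e·p (mod p^{K+2}), which is nonzero.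
    escapes-step : Returns K → Escapes K → (p ≡ 2 → CycleMultiplier≡1 (p * p) K) → Escapes (suc K)
    escapes-step returns escapes unit² z returns₂ = e≢0 e≡0
      where
      E e a : ℕ
      E = δ-iter P z
      e = proj₁ (return-shift₂ returns escapes z)
      e≢0 : ¬ (e ≡ 0 [mod p ])
      e≢0 = proj₁ (proj₂ (return-shift₂ returns escapes z))
      shift : fold z g₂ P ≡ z + P * e [mod p * (p * P) ]
      shift = proj₂ (proj₂ (return-shift₂ returns escapes z))
      a = proj₁ (mod-lift p (mod-sym (multiplier-unit returns escapes z)))
      E≡1+pa : E ≡ 1 + p * a [mod p * p ]
      E≡1+pa = proj₂ (mod-lift p (mod-sym (multiplier-unit returns escapes z)))
      p≡2⇒a≡0 : p ≡ 2 → a ≡ 0 [mod p ]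
      p≡2⇒a≡0 p≡2 = *-cancel-mod p (+-cancelˡ-mod 1
                      (mod-trans (mod-sym E≡1+pa) (mod-trans (unit² p≡2 z) (mod-reflexive (sym (x+n*0≡x 1 p))))))
      geometric≡0 : geometric e E p ≡ 0 [mod p * p ]
      geometric≡0 = shift-cancel-mod (p * p) (mod-≡ (sym (*-assoc p p P)) (begin
        z + P * geometric e E p     ≈⟨ geometric-iterate shift p ⟨
        fold z g₂ (p * P)           ≈⟨ returns₂ ⟩
        z                           ≡⟨ x+n*0≡x z P ⟨
        z + P * 0                   ∎))
        where open ModReasoning (p * (p * P))
      e≡0 : e ≡ 0 [mod p ]
      e≡0 = *-cancel-mod p (begin
        p * e               ≡⟨ *-comm p e ⟩
        e * p               ≈⟨ geometric-mod-p² pr E≡1+pa p≡2⇒a≡0 e ⟨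
        geometric e E p     ≈⟨ geometric≡0 ⟩
        0                   ≡⟨ *-zeroʳ p ⟨
        p * 0               ∎)
        where open ModReasoning (p * p)

  -- Transitivity at K and K + 1 yields Returns, Escapes and CycleMultiplier≡1 p at K; only for p = 2 is
  -- the multiplier condition modulo p² needed in addition.
  Invariant : ℕ → Set
  Invariant K = TransitiveMod p f K × TransitiveMod p f (suc K) × (p ≡ 2 → CycleMultiplier≡1 (p * p) K)

  invariant-step : ∀ {K} → N ≤ K → Invariant K → Invariant (suc K)
  invariant-step {K} N≤K (tr , tr₁ , unit²) =
    tr₁ , AboveN.transitive-step (m≤n⇒m≤1+n N≤K) tr₁ escapes₁ , λ _ → AboveN.multiplier-unit² N≤K returns unit
    where
    returns : Returns K
    returns = transitive⇒returns N≤K tr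
    escapes : Escapes K
    escapes = transitive⇒escapes N≤K tr₁
    unit : CycleMultiplier≡1 p K
    unit = AboveN.multiplier-unit N≤K returns escapes
    escapes₁ : Escapes (suc K)
    escapes₁ = AboveN.escapes-step N≤K returns escapes unit²

  invariant⇒ergodic : ∀ {K} → N ≤ K → Invariant K → AsymptoticallyErgodic p f
  invariant⇒ergodic {K} N≤K inv = K , λ k K≤k → subst (TransitiveMod p f) (m∸n+n≡m K≤k) (proj₁ (invariant-above (k ∸ K)))
    where
    invariant-above : ∀ d → Invariant (d + K)
    invariant-above zero    = inv
    invariant-above (suc d) = invariant-step (≤-trans N≤K (m≤n+m K d)) (invariant-above d)

  ergodic⇒transitive : AsymptoticallyErgodic p f → ∀ {L} → N ≤ L → TransitiveMod p f L
  ergodic⇒transitive (k₀ , tr) {L} N≤L = descend k₀ (tr (k₀ + L) (m≤m+n k₀ L))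
    where
    descend : ∀ d → TransitiveMod p f (d + L) → TransitiveMod p f L
    descend zero    tr = tr
    descend (suc d) tr = descend d (transitive-descends (≤-trans N≤L (m≤n+m L d)) tr)

  transitive⇒invariant-odd : p ≢ 2 → TransitiveMod p f (suc N) → Invariant N
  transitive⇒invariant-odd p≢2 tr₁ = transitive-descends ≤-refl tr₁ , tr₁ , λ p≡2 → contradiction p≡2 p≢2

  transitive⇒invariant : TransitiveMod p f (2 + N) → Invariant (suc N)
  transitive⇒invariant tr₂ = tr₁ , tr₂ , λ _ → AboveN.multiplier-unit² ≤-refl returns unit
    where
    tr₁ : TransitiveMod p f (suc N)
    tr₁ = transitive-descends (n≤1+n N) tr₂
    returns : Returns N
    returns = transitive⇒returns ≤-refl (transitive-descends ≤-refl tr₁)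
    unit : CycleMultiplier≡1 p N
    unit = AboveN.multiplier-unit ≤-refl returns (transitive⇒escapes ≤-refl tr₁)

theorem3p14 : (p : ℕ) → (pr : Prime p) → .{{_ : NonZero p}} →
    (f : ℤp p → ℤp p) → Respects≈ p f →
    (N : ℕ) → IsNk p 2 f N →
    (p ≢ 2 → (AsymptoticallyErgodic p f ⇔ TransitiveMod p f (N + 1)))
      × (p ≡ 2 → (AsymptoticallyErgodic p f ⇔ TransitiveMod p f (N + 2)))
theorem3p14 p pr f f-resp N (ud , _) = odd , two
  where
  open Ergodicity pr f f-resp ud
  odd : p ≢ 2 → (AsymptoticallyErgodic p f ⇔ TransitiveMod p f (N + 1))
  odd p≢2 = mk⇔ (λ ergodic → ergodic⇒transitive ergodic (m≤m+n N 1))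
                (λ tr → invariant⇒ergodic ≤-refl (transitive⇒invariant-odd p≢2 (subst (TransitiveMod p f) (+-comm N 1) tr)))
  two : p ≡ 2 → (AsymptoticallyErgodic p f ⇔ TransitiveMod p f (N + 2))
  two _ = mk⇔ (λ ergodic → ergodic⇒transitive ergodic (m≤m+n N 2))
              (λ tr → invariant⇒ergodic (n≤1+n N) (transitive⇒invariant (subst (TransitiveMod p f) (+-comm N 2) tr)))
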